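{- Let $V$ be a finite set of cardinality $n \geq 2$, let $f: 2^V \to \mathbb{R}$ be a submodular set function, and let $(v_1, \dots, v_n)$ be a minimum capacity ordering (MC-ordering) of $V$ with respect to $f$. Then for every subset $X \subsetneq V$ with $|X \cap \{v_{n-1}, v_n\}| = 1$, \[ f(X) + f(V \setminus X) \geq \min_{x \in X} f(\{x\}) + f(V_{n-1}). \]
   Context: For an ordering $(v_1,\dots,v_n)$ of $V$, write $V_0 := \varnothing$ and $V_i := \{v_1,\dots,v_i\}$ for $i=1,\dots,n$. An ordering $(v_1,\dots,v_n)$ of $V$ is a minimum capacity ordering (MC-ordering) with respect to a set function $f: 2^V \to \mathbb{R}$ if $f(V_{i-1} \cup \{v_i\}) \leq f(V_{i-1} \cup \{v_j\})$ holds for every pair $(i,j)$ with $1 \leq i \leq j \leq n$. -}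

module Defs where

open import Level using (Level; suc; _⊔_)
open import Data.Nat as ℕ using (ℕ; zero; suc; _<?_)
open import Data.Fin using (Fin; fromℕ<)
open import Data.Fin.Subset using (Subset; ⊥; ⁅_⁆; _∪_; _∩_; _∈_)
open import Relation.Binary.PropositionalEquality using (_≡_)
open import Relation.Nullary using (yes; no)
open import Relation.Binary.Definitions using (Total)
open import Relation.Binary.Structures using (IsPartialOrder)

-- A totally ordered abelian group (the role of ℝ with +, ≤ in the paper).
record OrderedAbelianGroup (c ℓ : Level) : Set (Level.suc (c ⊔ ℓ)) where
  infixl 6 _+_
  infix 4 _≤_
  field
    Carrier   : Set c
    _+_       : Carrier → Carrier → Carrier
    0#        : Carrier
    -_        : Carrier → Carrier
    _≤_       : Carrier → Carrier → Set ℓ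
    +-assoc   : ∀ x y z → (x + y) + z ≡ x + (y + z)
    +-comm    : ∀ x y → x + y ≡ y + x
    +-identityˡ : ∀ x → 0# + x ≡ x
    -‿inverseˡ : ∀ x → (- x) + x ≡ 0#
    ≤-isPartialOrder : IsPartialOrder _≡_ _≤_
    ≤-total   : Total _≤_
    +-monoˡ-≤ : ∀ {x y} z → x ≤ y → x + z ≤ y + z

module _ {c ℓ} (R : OrderedAbelianGroup c ℓ) where
  open OrderedAbelianGroup R

  Submodular : ∀ {n} → (Subset n → Carrier) → Set ℓ
  Submodular f = ∀ X Y → f (X ∪ Y) + f (X ∩ Y) ≤ f X + f Y

  IsMinSingleton : ∀ {n} → (Subset n → Carrier) → Subset n → Carrier → Set (c ⊔ ℓ)
  IsMinSingleton f X m =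
    (Data.Product.Σ (Fin _) λ x → x ∈ X Data.Product.× f ⁅ x ⁆ ≡ m)
    Data.Product.× (∀ x → x ∈ X → m ≤ f ⁅ x ⁆)
    where import Data.Product

-- For an ordering σ (v_{k+1} = σ k, 0-based indices), prefix σ i = V_i = {v_1,…,v_i}.
prefix : ∀ {n} → (Fin n → Fin n) → ℕ → Subset n
prefix σ zero = ⊥
prefix {n} σ (suc i) with i <? n
... | yes p = prefix σ i ∪ ⁅ σ (fromℕ< p) ⁆
... | no _  = prefix σ i

module _ {c ℓ} (R : OrderedAbelianGroup c ℓ) where
  open OrderedAbelianGroup R
  open import Data.Fin using (toℕ; _≤_)

  -- MC-ordering: f(V_{i-1} ∪ {v_i}) ≤ f(V_{i-1} ∪ {v_j}) for all i ≤ j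
  -- (here i, j are 0-based, so V_{i-1} becomes prefix σ (toℕ i)).
  IsMCOrdering : ∀ {n} → (Subset n → Carrier) → (Fin n → Fin n) → Set ℓ
  IsMCOrdering f σ = ∀ (i j : Fin _) → i Data.Fin.≤ j →
    OrderedAbelianGroup._≤_ R (f (prefix σ (toℕ i) ∪ ⁅ σ i ⁆)) (f (prefix σ (toℕ i) ∪ ⁅ σ j ⁆))

-- Queyranne's pendant-pair argument.  Let μ be the least f({x}), x ∈ X, and
-- call (V_i, w) bounded when μ + f(V_i) ≤ f((V_i ∪ {w}) ∩ X) + f((V_i ∪ {w}) ∖ X).
-- By induction on i, (V_i, w) is bounded for every later w that X separates from
-- v_i.  Adding v_i to V_{i-1} only costs what diminishing returns of f allow:
-- if v_{i-1} lies on v_i's side, (V_{i-1}, w) is bounded already; otherwise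
-- (V_{i-1}, v_i) is, and the MC property lets w take the place of v_i.  For
-- i = n-1 and w = v_n, the set V_{n-1} ∪ {v_n} is all of V.
module Submission where

open import Defs
open import Data.Nat using (ℕ; suc)
import Data.Nat as ℕ
open import Data.Nat.Base using (s≤s⁻¹)
import Data.Nat.Properties as ℕₚ
open import Data.Fin as Fin using (Fin; zero; suc; toℕ; fromℕ; fromℕ<; inject₁)
open import Data.Fin.Induction using (<-weakInduction)
import Data.Fin.Properties as Finₚ
open import Data.Fin.Properties
  using (toℕ<n; toℕ-injective; toℕ-inject₁; toℕ-fromℕ; toℕ-fromℕ<; fromℕ<-toℕ; ≤̄⇒inject₁<)
open import Data.Fin.Subset using (Subset; ⊤; ⊥; ⁅_⁆; _∪_; _∩_; ∁; ∣_∣; _∈_; _∉_; inside; outside)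
open import Data.Fin.Subset.Properties
  using ( ∉⊥; ⊆⊤; ⊆-antisym; ∣⊥∣≡0; ∣⁅x⁆∣≡1; x∈⁅x⁆; x∈⁅y⁆⇒x≡y; x∈p∪q⁺; x∈p∪q⁻
        ; x∈p⇒x∉∁p; x∉p⇒x∈∁p; _∈?_
        ; ∩-comm; ∩-assoc; ∩-idem; ∩-zeroˡ; ∩-identityˡ; ∩-distribʳ-∪
        ; ∪-comm; ∪-assoc; ∪-identityˡ; ∪-identityʳ; ∪-abs-∩ )
open import Data.Fin.Permutation using (Permutation′; _⟨$⟩ʳ_; _⟨$⟩ˡ_; inverseʳ)
open import Data.Product using (_×_; _,_)
open import Data.Sum using (_⊎_; inj₁; inj₂; [_,_]′)
open import Data.Vec.Base using (_∷_; here; there)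
open import Algebra.Bundles using (CommutativeMonoid)
import Algebra.Solver.CommutativeMonoid as CommutativeMonoidSolver
open import Function using (_∘_; Injective)
open import Function.Bundles using (Injection)
open import Function.Properties.Inverse using (↔⇒↣)
open import Relation.Binary.PropositionalEquality
  using (_≡_; _≢_; refl; sym; trans; cong; cong₂; subst; subst₂; isEquivalence; module ≡-Reasoning)
open import Relation.Binary.Structures using (IsPartialOrder)
open import Relation.Nullary using (Dec; yes; no; contradiction)

⁅x⁆∩p≡⁅x⁆ : ∀ {n} {x : Fin n} {p : Subset n} → x ∈ p → ⁅ x ⁆ ∩ p ≡ ⁅ x ⁆
⁅x⁆∩p≡⁅x⁆ {x = zero}  {inside ∷ p} here        = cong (inside ∷_) (∩-zeroˡ p)
⁅x⁆∩p≡⁅x⁆ {x = suc x} {_ ∷ p}      (there x∈p) = cong (outside ∷_) (⁅x⁆∩p≡⁅x⁆ x∈p)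

⁅x⁆∩p≡⊥ : ∀ {n} {x : Fin n} {p : Subset n} → x ∉ p → ⁅ x ⁆ ∩ p ≡ ⊥
⁅x⁆∩p≡⊥ {x = zero}  {inside ∷ p}  x∉p = contradiction here x∉p
⁅x⁆∩p≡⊥ {x = zero}  {outside ∷ p} x∉p = cong (outside ∷_) (∩-zeroˡ p)
⁅x⁆∩p≡⊥ {x = suc x} {_ ∷ p}       x∉p = cong (outside ∷_) (⁅x⁆∩p≡⊥ (x∉p ∘ there))

x∈p⇒[q∪⁅x⁆]∩p≡[q∩p]∪⁅x⁆ : ∀ {n} {x : Fin n} {p} q → x ∈ p → (q ∪ ⁅ x ⁆) ∩ p ≡ (q ∩ p) ∪ ⁅ x ⁆
x∈p⇒[q∪⁅x⁆]∩p≡[q∩p]∪⁅x⁆ {x = x} {p} q x∈p =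
  trans (∩-distribʳ-∪ p q ⁅ x ⁆) (cong ((q ∩ p) ∪_) (⁅x⁆∩p≡⁅x⁆ x∈p))

x∉p⇒[q∪⁅x⁆]∩p≡q∩p : ∀ {n} {x : Fin n} {p} q → x ∉ p → (q ∪ ⁅ x ⁆) ∩ p ≡ q ∩ p
x∉p⇒[q∪⁅x⁆]∩p≡q∩p {x = x} {p} q x∉p =
  trans (∩-distribʳ-∪ p q ⁅ x ⁆) (trans (cong ((q ∩ p) ∪_) (⁅x⁆∩p≡⊥ x∉p)) (∪-identityʳ (q ∩ p)))

[p∪q]∪r≡[p∪r]∪q : ∀ {n} (p q r : Subset n) → (p ∪ q) ∪ r ≡ (p ∪ r) ∪ q
[p∪q]∪r≡[p∪r]∪q p q r = trans (∪-assoc p q r) (trans (cong (p ∪_) (∪-comm q r)) (sym (∪-assoc p r q)))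

∣⁅x⁆∪⁅y⁆∣≡2 : ∀ {n} {x y : Fin n} → x ≢ y → ∣ ⁅ x ⁆ ∪ ⁅ y ⁆ ∣ ≡ 2
∣⁅x⁆∪⁅y⁆∣≡2 {x = zero}  {zero}  x≢y = contradiction refl x≢y
∣⁅x⁆∪⁅y⁆∣≡2 {x = zero}  {suc y} _   = cong suc (trans (cong ∣_∣ (∪-identityˡ ⁅ y ⁆)) (∣⁅x⁆∣≡1 y))
∣⁅x⁆∪⁅y⁆∣≡2 {x = suc x} {zero}  _   = cong suc (trans (cong ∣_∣ (∪-identityʳ ⁅ x ⁆)) (∣⁅x⁆∣≡1 x))
∣⁅x⁆∪⁅y⁆∣≡2 {x = suc x} {suc y} x≢y = ∣⁅x⁆∪⁅y⁆∣≡2 (x≢y ∘ cong suc)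

Separated : ∀ {n} → Subset n → Fin n → Fin n → Set
Separated p x y = (x ∈ p × y ∉ p) ⊎ (x ∉ p × y ∈ p)

∣p∩[⁅x⁆∪⁅y⁆]∣≡1⇒Separated : ∀ {n} {x y : Fin n} (p : Subset n) →
  x ≢ y → ∣ p ∩ (⁅ x ⁆ ∪ ⁅ y ⁆) ∣ ≡ 1 → Separated p x y
∣p∩[⁅x⁆∪⁅y⁆]∣≡1⇒Separated {n} {x} {y} p x≢y ∣∣≡1 with x ∈? p | y ∈? p
... | yes x∈p | no y∉p  = inj₁ (x∈p , y∉p)
... | no x∉p  | yes y∈p = inj₂ (x∉p , y∈p)
... | yes x∈p | yes y∈p = contradiction (trans (sym (∣⁅x⁆∪⁅y⁆∣≡2 x≢y)) (trans (cong ∣_∣ (sym both)) ∣∣≡1)) λ ()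
  where
  both : p ∩ (⁅ x ⁆ ∪ ⁅ y ⁆) ≡ ⁅ x ⁆ ∪ ⁅ y ⁆
  both = trans (∩-comm p _) (trans (∩-distribʳ-∪ p ⁅ x ⁆ ⁅ y ⁆) (cong₂ _∪_ (⁅x⁆∩p≡⁅x⁆ x∈p) (⁅x⁆∩p≡⁅x⁆ y∈p)))
... | no x∉p  | no y∉p  = contradiction (trans (sym (∣⊥∣≡0 n)) (trans (cong ∣_∣ (sym neither)) ∣∣≡1)) λ ()
  where
  neither : p ∩ (⁅ x ⁆ ∪ ⁅ y ⁆) ≡ ⊥
  neither = trans (∩-comm p _) (trans (∩-distribʳ-∪ p ⁅ x ⁆ ⁅ y ⁆) (trans (cong₂ _∪_ (⁅x⁆∩p≡⊥ x∉p) (⁅x⁆∩p≡⊥ y∉p)) (∪-identityʳ ⊥)))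

module _ {n} (σ : Fin n → Fin n) where

  prefix-suc : ∀ i → prefix σ (suc (toℕ i)) ≡ prefix σ (toℕ i) ∪ ⁅ σ i ⁆
  prefix-suc i with toℕ i ℕₚ.<? n
  ... | yes i<n = cong (λ j → prefix σ (toℕ i) ∪ ⁅ σ j ⁆) (fromℕ<-toℕ i i<n)
  ... | no  i≮n = contradiction (toℕ<n i) i≮n

  ∈-prefix : ∀ {j} k → toℕ k ℕ.< j → σ k ∈ prefix σ j
  ∈-prefix {suc j} k k<1+j with j ℕₚ.<? n
  ... | no j≮n = ∈-prefix k (ℕₚ.<-≤-trans (toℕ<n k) (ℕₚ.≮⇒≥ j≮n))
  ... | yes j<n with toℕ k ℕₚ.≟ j
  ...   | yes k≡j = x∈p∪q⁺ (inj₂ (subst (λ i → σ k ∈ ⁅ σ i ⁆) k≡last (x∈⁅x⁆ (σ k))))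
    where
    k≡last : k ≡ fromℕ< j<n
    k≡last = toℕ-injective (trans k≡j (sym (toℕ-fromℕ< j<n)))
  ...   | no  k≢j = x∈p∪q⁺ (inj₁ (∈-prefix k (ℕₚ.≤∧≢⇒< (s≤s⁻¹ k<1+j) k≢j)))

  ∉-prefix : Injective _≡_ _≡_ σ → ∀ {j} k → j ℕ.≤ toℕ k → σ k ∉ prefix σ j
  ∉-prefix σ-injective {ℕ.zero} k _ = ∉⊥
  ∉-prefix σ-injective {suc j}  k j<k with j ℕₚ.<? n
  ... | no  _   = ∉-prefix σ-injective k (ℕₚ.<⇒≤ j<k)
  ... | yes j<n = [ ∉-prefix σ-injective k (ℕₚ.<⇒≤ j<k) , σk∉⁅σj⁆ ]′ ∘ x∈p∪q⁻ _ _
    where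
    σk∉⁅σj⁆ : σ k ∉ ⁅ σ (fromℕ< j<n) ⁆
    σk∉⁅σj⁆ σk∈ = ℕₚ.<-irrefl toℕk≡j j<k
      where
      toℕk≡j : j ≡ toℕ k
      toℕk≡j = trans (sym (toℕ-fromℕ< j<n)) (cong toℕ (sym (σ-injective (x∈⁅y⁆⇒x≡y _ σk∈))))

prefix-⊤ : ∀ {n} (π : Permutation′ n) → prefix (π ⟨$⟩ʳ_) n ≡ ⊤
prefix-⊤ {n} π = ⊆-antisym ⊆⊤ λ {x} _ →
  subst (_∈ prefix (π ⟨$⟩ʳ_) n) (inverseʳ π) (∈-prefix (π ⟨$⟩ʳ_) (π ⟨$⟩ˡ x) (toℕ<n _))

prefix-last : ∀ {n} (σ : Fin (suc n) → Fin (suc n)) → prefix σ n ∪ ⁅ σ (fromℕ n) ⁆ ≡ prefix σ (suc n)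
prefix-last {n} σ = begin
  prefix σ n ∪ ⁅ σ (fromℕ n) ⁆                ≡⟨ cong (λ t → prefix σ t ∪ ⁅ σ (fromℕ n) ⁆) (toℕ-fromℕ n) ⟨
  prefix σ (toℕ (fromℕ n)) ∪ ⁅ σ (fromℕ n) ⁆  ≡⟨ prefix-suc σ (fromℕ n) ⟨
  prefix σ (suc (toℕ (fromℕ n)))               ≡⟨ cong (prefix σ ∘ suc) (toℕ-fromℕ n) ⟩
  prefix σ (suc n)                             ∎
  where open ≡-Reasoning

module OrderedAbelianGroupProperties {c ℓ} (R : OrderedAbelianGroup c ℓ) where
  open OrderedAbelianGroup R
  open IsPartialOrder ≤-isPartialOrder public using () renaming (trans to ≤-trans)

  +-identityʳ : ∀ x → x + 0# ≡ x
  +-identityʳ x = trans (+-comm x 0#) (+-identityˡ x)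

  +-commutativeMonoid : CommutativeMonoid c c
  +-commutativeMonoid = record
    { Carrier = Carrier ; _≈_ = _≡_ ; _∙_ = _+_ ; ε = 0#
    ; isCommutativeMonoid = record
      { isMonoid = record
        { isSemigroup = record
          { isMagma = record { isEquivalence = isEquivalence ; ∙-cong = cong₂ _+_ }
          ; assoc = +-assoc }
        ; identity = +-identityˡ , +-identityʳ }
      ; comm = +-comm } }

  open CommutativeMonoidSolver +-commutativeMonoid using (solve; _⊜_; _⊕_)

  +-monoʳ-≤ : ∀ z {x y} → x ≤ y → z + x ≤ z + y
  +-monoʳ-≤ z {x} {y} x≤y = subst₂ _≤_ (+-comm x z) (+-comm y z) (+-monoˡ-≤ z x≤y)

  +-mono-≤ : ∀ {x y u v} → x ≤ y → u ≤ v → x + u ≤ y + v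
  +-mono-≤ {y = y} {u} x≤y u≤v = ≤-trans (+-monoˡ-≤ u x≤y) (+-monoʳ-≤ y u≤v)

  +-cancelʳ-≤ : ∀ z {x y} → x + z ≤ y + z → x ≤ y
  +-cancelʳ-≤ z {x} {y} = subst₂ _≤_ (cancel x) (cancel y) ∘ +-monoˡ-≤ (- z)
    where
    cancel : ∀ x → (x + z) + - z ≡ x
    cancel x = trans (+-assoc x z (- z))
      (trans (cong (x +_) (trans (+-comm z (- z)) (-‿inverseˡ z))) (+-identityʳ x))

  +-≤-combine : ∀ {a b c d p w} → p + c ≤ d + w → a + w ≤ c + b → a + p ≤ d + b
  +-≤-combine {a} {b} {c} {d} {p} {w} p+c≤d+w a+w≤c+b =
    +-cancelʳ-≤ (c + w) (subst₂ _≤_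
      (solve 6 (λ a b c d p w → (a ⊕ w) ⊕ (p ⊕ c) ⊜ (a ⊕ p) ⊕ (c ⊕ w)) refl a b c d p w)
      (solve 6 (λ a b c d p w → (c ⊕ b) ⊕ (d ⊕ w) ⊜ (d ⊕ b) ⊕ (c ⊕ w)) refl a b c d p w)
      (+-mono-≤ a+w≤c+b p+c≤d+w))

module _ {c ℓ} (R : OrderedAbelianGroup c ℓ) where
  open OrderedAbelianGroup R
  open OrderedAbelianGroupProperties R

  module _ {n} (f : Subset n → Carrier) where

    split : Subset n → Subset n → Subset n → Carrier
    split Z Z′ S = f (S ∩ Z) + f (S ∩ Z′)

    ≤-split-comm : ∀ {a Z Z′ S} → a ≤ split Z Z′ S → a ≤ split Z′ Z S
    ≤-split-comm {a} {Z} {Z′} {S} = subst (a ≤_) (+-comm (f (S ∩ Z)) (f (S ∩ Z′)))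

    split-bound-start : ∀ {a w Z Z′} → w ∉ Z → w ∈ Z′ → a ≤ f (⊥ ∪ ⁅ w ⁆) →
      a + f ⊥ ≤ split Z Z′ (⊥ ∪ ⁅ w ⁆)
    split-bound-start {a} {w} {Z} {Z′} w∉Z w∈Z′ a≤fw =
      subst (a + f ⊥ ≤_) (sym split≡) (subst (a + f ⊥ ≤_) (+-comm _ _) (+-monoˡ-≤ (f ⊥) a≤fw))
      where
      split≡ : split Z Z′ (⊥ ∪ ⁅ w ⁆) ≡ f ⊥ + f (⊥ ∪ ⁅ w ⁆)
      split≡ = cong₂ (λ A B → f A + f B)
        (trans (x∉p⇒[q∪⁅x⁆]∩p≡q∩p ⊥ w∉Z) (∩-zeroˡ Z))
        (trans (x∈p⇒[q∪⁅x⁆]∩p≡[q∩p]∪⁅x⁆ ⊥ w∈Z′) (cong (_∪ ⁅ w ⁆) (∩-zeroˡ Z′)))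

    module _ (f-sub : Submodular R f) where

      diminishing-returns : ∀ {x W} Z → x ∉ W →
        f (W ∪ ⁅ x ⁆) + f (W ∩ Z) ≤ f ((W ∩ Z) ∪ ⁅ x ⁆) + f W
      diminishing-returns {x} {W} Z x∉W =
        subst₂ (λ A B → f A + f B ≤ f ((W ∩ Z) ∪ ⁅ x ⁆) + f W) union meet (f-sub ((W ∩ Z) ∪ ⁅ x ⁆) W)
        where
        open ≡-Reasoning
        union : ((W ∩ Z) ∪ ⁅ x ⁆) ∪ W ≡ W ∪ ⁅ x ⁆
        union = begin
          ((W ∩ Z) ∪ ⁅ x ⁆) ∪ W  ≡⟨ ∪-comm _ W ⟩
          W ∪ ((W ∩ Z) ∪ ⁅ x ⁆)  ≡⟨ ∪-assoc W (W ∩ Z) ⁅ x ⁆ ⟨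
          (W ∪ (W ∩ Z)) ∪ ⁅ x ⁆  ≡⟨ cong (_∪ ⁅ x ⁆) (∪-abs-∩ W Z) ⟩
          W ∪ ⁅ x ⁆              ∎
        meet : ((W ∩ Z) ∪ ⁅ x ⁆) ∩ W ≡ W ∩ Z
        meet = begin
          ((W ∩ Z) ∪ ⁅ x ⁆) ∩ W  ≡⟨ x∉p⇒[q∪⁅x⁆]∩p≡q∩p (W ∩ Z) x∉W ⟩
          (W ∩ Z) ∩ W            ≡⟨ ∩-comm (W ∩ Z) W ⟩
          W ∩ (W ∩ Z)            ≡⟨ ∩-assoc W W Z ⟨
          (W ∩ W) ∩ Z            ≡⟨ cong (_∩ Z) (∩-idem W) ⟩
          W ∩ Z                  ∎

      split-bound-extend : ∀ {a b x W} Z → x ∉ W → a + f W ≤ f (W ∩ Z) + b →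
        a + f (W ∪ ⁅ x ⁆) ≤ f ((W ∩ Z) ∪ ⁅ x ⁆) + b
      split-bound-extend Z x∉W = +-≤-combine (diminishing-returns Z x∉W)

      split-bound-keep : ∀ {a u w W Z Z′} → u ∈ Z → u ∉ Z′ → w ∉ Z → u ∉ W →
        a + f W ≤ split Z Z′ (W ∪ ⁅ w ⁆) →
        a + f (W ∪ ⁅ u ⁆) ≤ split Z Z′ ((W ∪ ⁅ u ⁆) ∪ ⁅ w ⁆)
      split-bound-keep {a} {u} {w} {W} {Z} {Z′} u∈Z u∉Z′ w∉Z u∉W bound =
        subst (a + f (W ∪ ⁅ u ⁆) ≤_) (sym after)
          (split-bound-extend Z u∉W (subst (a + f W ≤_) before bound))
        where
        before : split Z Z′ (W ∪ ⁅ w ⁆) ≡ f (W ∩ Z) + f ((W ∪ ⁅ w ⁆) ∩ Z′)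
        before = cong (λ A → f A + _) (x∉p⇒[q∪⁅x⁆]∩p≡q∩p W w∉Z)
        after : split Z Z′ ((W ∪ ⁅ u ⁆) ∪ ⁅ w ⁆) ≡ f ((W ∩ Z) ∪ ⁅ u ⁆) + f ((W ∪ ⁅ w ⁆) ∩ Z′)
        after = cong₂ (λ A B → f A + f B)
          (trans (x∉p⇒[q∪⁅x⁆]∩p≡q∩p (W ∪ ⁅ u ⁆) w∉Z) (x∈p⇒[q∪⁅x⁆]∩p≡[q∩p]∪⁅x⁆ W u∈Z))
          (trans (cong (_∩ Z′) ([p∪q]∪r≡[p∪r]∪q W ⁅ u ⁆ ⁅ w ⁆)) (x∉p⇒[q∪⁅x⁆]∩p≡q∩p (W ∪ ⁅ w ⁆) u∉Z′))

      split-bound-switch : ∀ {a u w W Z Z′} → w ∈ Z → w ∉ Z′ → u ∉ Z → w ∉ W →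
        f (W ∪ ⁅ u ⁆) ≤ f (W ∪ ⁅ w ⁆) →
        a + f W ≤ split Z Z′ (W ∪ ⁅ u ⁆) →
        a + f (W ∪ ⁅ u ⁆) ≤ split Z Z′ ((W ∪ ⁅ u ⁆) ∪ ⁅ w ⁆)
      split-bound-switch {a} {u} {w} {W} {Z} {Z′} w∈Z w∉Z′ u∉Z w∉W fu≤fw bound =
        subst (a + f (W ∪ ⁅ u ⁆) ≤_) (sym after)
          (≤-trans (+-monoʳ-≤ a fu≤fw) (split-bound-extend Z w∉W (subst (a + f W ≤_) before bound)))
        where
        before : split Z Z′ (W ∪ ⁅ u ⁆) ≡ f (W ∩ Z) + f ((W ∪ ⁅ u ⁆) ∩ Z′)
        before = cong (λ A → f A + _) (x∉p⇒[q∪⁅x⁆]∩p≡q∩p W u∉Z)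
        after : split Z Z′ ((W ∪ ⁅ u ⁆) ∪ ⁅ w ⁆) ≡ f ((W ∩ Z) ∪ ⁅ w ⁆) + f ((W ∪ ⁅ u ⁆) ∩ Z′)
        after = cong₂ (λ A B → f A + f B)
          (trans (x∈p⇒[q∪⁅x⁆]∩p≡[q∩p]∪⁅x⁆ (W ∪ ⁅ u ⁆) w∈Z) (cong (_∪ ⁅ w ⁆) (x∉p⇒[q∪⁅x⁆]∩p≡q∩p W u∉Z)))
          (x∉p⇒[q∪⁅x⁆]∩p≡q∩p (W ∪ ⁅ u ⁆) w∉Z′)

  module MinimumCapacityOrdering
    {n} {f : Subset (suc n) → Carrier} (f-sub : Submodular R f)
    {σ : Fin (suc n) → Fin (suc n)} (σ-injective : Injective _≡_ _≡_ σ) (σ-mc : IsMCOrdering R f σ)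
    (X : Subset (suc n)) {μ : Carrier} (μ≤ : ∀ x → x ∈ X → μ ≤ f ⁅ x ⁆)
    where

    Bounded : Subset (suc n) → Fin (suc n) → Set ℓ
    Bounded W w = μ + f W ≤ split f X (∁ X) (W ∪ ⁅ w ⁆)

    -- prefix σ (suc (toℕ i)) is the paper's V_{i+1}: indices of σ start at 0.
    Invariant : Fin (suc n) → Set ℓ
    Invariant i = ∀ k → i Fin.< k → Separated X (σ i) (σ k) → Bounded (prefix σ (suc (toℕ i))) (σ k)

    invariant-zero : Invariant zero
    invariant-zero k _ separated =
      subst (λ W → Bounded W (σ k)) (sym (prefix-suc σ zero)) (start separated)
      where
      μ≤f⁅⁆ : ∀ {x} → x ∈ X → μ ≤ f (⊥ ∪ ⁅ x ⁆)
      μ≤f⁅⁆ {x} x∈X = subst (λ A → μ ≤ f A) (sym (∪-identityˡ ⁅ x ⁆)) (μ≤ x x∈X)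
      start : Separated X (σ zero) (σ k) → Bounded (⊥ ∪ ⁅ σ zero ⁆) (σ k)
      start (inj₁ (u∈X , w∉X)) =
        split-bound-keep f f-sub u∈X (x∈p⇒x∉∁p u∈X) w∉X ∉⊥
          (split-bound-start f w∉X (x∉p⇒x∈∁p w∉X) (≤-trans (μ≤f⁅⁆ u∈X) (σ-mc zero k ℕ.z≤n)))
      start (inj₂ (u∉X , w∈X)) = ≤-split-comm f
        (split-bound-keep f f-sub (x∉p⇒x∈∁p u∉X) u∉X (x∈p⇒x∉∁p w∈X) ∉⊥
          (split-bound-start f (x∈p⇒x∉∁p w∈X) w∈X (μ≤f⁅⁆ w∈X)))

    invariant-suc : ∀ j → Invariant (inject₁ j) → Invariant (suc j)
    invariant-suc j ih k j+1<k separated =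
      subst (λ W → Bounded W (σ k)) (sym (prefix-suc σ (suc j))) (step separated (σ (inject₁ j) ∈? X))
      where
      W = prefix σ (suc (toℕ j))
      j<j+1 : inject₁ j Fin.< suc j
      j<j+1 = ≤̄⇒inject₁< Finₚ.≤-refl
      j<k : inject₁ j Fin.< k
      j<k = Finₚ.<-trans j<j+1 j+1<k
      ih′ : ∀ k → inject₁ j Fin.< k → Separated X (σ (inject₁ j)) (σ k) → Bounded W (σ k)
      ih′ k j<k s = subst (λ W → Bounded W (σ k)) (cong (prefix σ ∘ suc) (toℕ-inject₁ j)) (ih k j<k s)
      u∉W : σ (suc j) ∉ W
      u∉W = ∉-prefix σ σ-injective (suc j) ℕₚ.≤-refl
      w∉W : σ k ∉ W
      w∉W = ∉-prefix σ σ-injective k (ℕₚ.<⇒≤ j+1<k)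
      fu≤fw : f (W ∪ ⁅ σ (suc j) ⁆) ≤ f (W ∪ ⁅ σ k ⁆)
      fu≤fw = σ-mc (suc j) k (ℕₚ.<⇒≤ j+1<k)
      step : Separated X (σ (suc j)) (σ k) → Dec (σ (inject₁ j) ∈ X) → Bounded (W ∪ ⁅ σ (suc j) ⁆) (σ k)
      step (inj₁ (u∈X , w∉X)) (yes p∈X) =
        split-bound-keep f f-sub u∈X (x∈p⇒x∉∁p u∈X) w∉X u∉W (ih′ k j<k (inj₁ (p∈X , w∉X)))
      step (inj₁ (u∈X , w∉X)) (no p∉X) = ≤-split-comm f
        (split-bound-switch f f-sub (x∉p⇒x∈∁p w∉X) w∉X (x∈p⇒x∉∁p u∈X) w∉W fu≤fw
          (≤-split-comm f (ih′ (suc j) j<j+1 (inj₂ (p∉X , u∈X)))))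
      step (inj₂ (u∉X , w∈X)) (yes p∈X) =
        split-bound-switch f f-sub w∈X (x∈p⇒x∉∁p w∈X) u∉X w∉W fu≤fw (ih′ (suc j) j<j+1 (inj₁ (p∈X , u∉X)))
      step (inj₂ (u∉X , w∈X)) (no p∉X) = ≤-split-comm f
        (split-bound-keep f f-sub (x∉p⇒x∈∁p u∉X) u∉X (x∈p⇒x∉∁p w∈X) u∉W
          (≤-split-comm f (ih′ k j<k (inj₂ (p∉X , w∈X)))))

    invariant : ∀ i → Invariant i
    invariant = <-weakInduction Invariant invariant-zero invariant-suc

lemma1 : ∀ {c ℓ} (R : OrderedAbelianGroup c ℓ) (m : ℕ)
    (f : Subset (suc (suc m)) → OrderedAbelianGroup.Carrier R)
    (σ : Permutation′ (suc (suc m))) →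
    Submodular R f →
    IsMCOrdering R f (σ ⟨$⟩ʳ_) →
    (X : Subset (suc (suc m))) → X ≢ ⊤ →
    ∣ X ∩ (⁅ σ ⟨$⟩ʳ inject₁ (fromℕ m) ⁆ ∪ ⁅ σ ⟨$⟩ʳ fromℕ (suc m) ⁆) ∣ ≡ 1 →
    (μ : OrderedAbelianGroup.Carrier R) → IsMinSingleton R f X μ →
    OrderedAbelianGroup._≤_ R
      (OrderedAbelianGroup._+_ R μ (f (prefix (σ ⟨$⟩ʳ_) (suc m))))
      (OrderedAbelianGroup._+_ R (f X) (f (∁ X)))
lemma1 R m f σ f-sub σ-mc X _ ∣∣≡1 μ (_ , μ≤) =
  subst₂ (λ W S → μ + f W ≤ S) V≡ split≡ (invariant penultimate last penultimate<last separated)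
  where
  open OrderedAbelianGroup R
  open MinimumCapacityOrdering R f-sub (Injection.injective (↔⇒↣ σ)) σ-mc X μ≤
  penultimate = inject₁ (fromℕ m)
  last = fromℕ (suc m)
  penultimate<last : penultimate Fin.< last
  penultimate<last = ≤̄⇒inject₁< Finₚ.≤-refl
  separated : Separated X (σ ⟨$⟩ʳ penultimate) (σ ⟨$⟩ʳ last)
  separated = ∣p∩[⁅x⁆∪⁅y⁆]∣≡1⇒Separated X
    (Finₚ.<⇒≢ penultimate<last ∘ Injection.injective (↔⇒↣ σ)) ∣∣≡1
  V≡ : prefix (σ ⟨$⟩ʳ_) (suc (toℕ penultimate)) ≡ prefix (σ ⟨$⟩ʳ_) (suc m)
  V≡ = cong (prefix (σ ⟨$⟩ʳ_) ∘ suc) (trans (toℕ-inject₁ (fromℕ m)) (toℕ-fromℕ m))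
  split≡ : split R f X (∁ X) (prefix (σ ⟨$⟩ʳ_) (suc (toℕ penultimate)) ∪ ⁅ σ ⟨$⟩ʳ last ⁆) ≡ f X + f (∁ X)
  split≡ = trans (cong (split R f X (∁ X)) whole) (cong₂ (λ A B → f A + f B) (∩-identityˡ X) (∩-identityˡ (∁ X)))
    where
    whole : prefix (σ ⟨$⟩ʳ_) (suc (toℕ penultimate)) ∪ ⁅ σ ⟨$⟩ʳ last ⁆ ≡ ⊤
    whole = trans (cong (_∪ ⁅ σ ⟨$⟩ʳ last ⁆) V≡) (trans (prefix-last (σ ⟨$⟩ʳ_)) (prefix-⊤ σ))
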